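{- Let $n,m_1,m_2,s$ be positive integers with $m_1\ge m_2$, $s$ a positive integer all of whose prime factors lie in $\{2,3,5,7\}$, satisfying $n2^n+1=m_1!+m_2!+s$. If $m_1\ge 6$, then $n>m_1$. -}

module Defs where

open import Data.Nat using (ℕ)
open import Data.Nat.Divisibility using (_∣_)
open import Data.Nat.Primality using (Prime)
open import Data.Sum using (_⊎_)
open import Relation.Binary.PropositionalEquality using (_≡_)

PrimeFactorsIn2357 : ℕ → Set
PrimeFactorsIn2357 s = ∀ p → Prime p → p ∣ s → p ≡ 2 ⊎ p ≡ 3 ⊎ p ≡ 5 ⊎ p ≡ 7

-- If n ≤ m₁ then n·2ⁿ ≤ m₁·2^m₁, and factorials outgrow m·2^m from m = 6 on
-- (6·2⁶ = 384 < 720), so n·2ⁿ + 1 ≤ m₁! < m₁! + m₂! + s.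
module Submission where

open import Defs
open import Data.Nat using (ℕ; _+_; _*_; _^_; _≤_; _≰_; _<_; _≥_; _>_; _!; zero; suc; s≤s; z≤n; _<?_)
open import Relation.Nullary.Decidable using (toWitness)
open import Data.Nat.Properties
open import Relation.Binary.PropositionalEquality using (_≡_; refl)
open import Data.Product using (_,_)

2^[6+k]<[5+k]! : ∀ k → 2 ^ (6 + k) < (5 + k) !
2^[6+k]<[5+k]! zero    = toWitness {a? = 64 <? 120} _
2^[6+k]<[5+k]! (suc k) =
  <-≤-trans (*-monoʳ-< 2 (2^[6+k]<[5+k]! k)) (*-monoˡ-≤ ((5 + k) !) {2} {6 + k} (s≤s (s≤s z≤n)))

m*2^m<m! : ∀ m → 6 ≤ m → m * 2 ^ m < m !
m*2^m<m! m 6≤m with k , refl ← m≤n⇒∃[o]m+o≡n 6≤m = *-monoʳ-< (6 + k) (2^[6+k]<[5+k]! k)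

m*2^m-mono-≤ : ∀ {m n} → m ≤ n → m * 2 ^ m ≤ n * 2 ^ n
m*2^m-mono-≤ m≤n = *-mono-≤ m≤n (^-monoʳ-≤ 2 m≤n)

lemma2p10 : (n m₁ m₂ s : ℕ) → 1 ≤ n → 1 ≤ m₁ → 1 ≤ m₂ → 1 ≤ s →
    m₁ ≥ m₂ → PrimeFactorsIn2357 s →
    n * 2 ^ n + 1 ≡ m₁ ! + m₂ ! + s →
    m₁ ≥ 6 → n > m₁
lemma2p10 n m₁ m₂ s _ _ _ 1≤s _ _ eq 6≤m₁ = ≰⇒> n≰m₁
  where
  n≰m₁ : n ≰ m₁
  n≰m₁ n≤m₁ = <-irrefl eq (begin-strict
    n * 2 ^ n + 1    <⟨ +-monoˡ-< 1 (≤-<-trans (m*2^m-mono-≤ n≤m₁) (m*2^m<m! m₁ 6≤m₁)) ⟩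
    m₁ ! + 1         ≤⟨ +-monoʳ-≤ (m₁ !) 1≤s ⟩
    m₁ ! + s         ≤⟨ +-monoˡ-≤ s (m≤m+n (m₁ !) (m₂ !)) ⟩
    m₁ ! + m₂ ! + s  ∎)
    where open ≤-Reasoning
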